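{- For every integer $n\ge 7$, $$ \sum_{l=0}^5(-1)^l\binom{5}{l}\sum_{\substack{j_1+j_2+j_3+j_4=n-2l\\ j_1,j_2,j_3,j_4\ge 1}}B_{j_1}B_{j_2}B_{j_3}B_{j_4} =\binom{n-1}{3}B_{n-3}-\frac{(n-3)(n-5)(n-7)}{3}B_{n-5}+\binom{n-7}{3}B_{n-7}\,. $$
   Context: The balancing numbers $B_n$ are defined by $B_0=0$, $B_1=1$ and $B_n=6B_{n-1}-B_{n-2}$ for $n\ge 2$. The inner sum is over ordered quadruples of positive integers with the indicated sum (empty, hence $0$, if there is none). $\binom{m}{3}=m(m-1)(m-2)/6$. -}

module Defs where

open import Data.Nat as ℕ using (ℕ; zero; suc)
open import Data.Integer using (ℤ; +_; _+_; _-_; _*_; -_)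
open import Data.List using (List; foldr; applyUpTo)
open import Data.Bool using (if_then_else_)
open import Relation.Nullary.Decidable using (⌊_⌋)

B : ℕ → ℤ
B zero = + 0
B (suc zero) = + 1
B (suc (suc n)) = + 6 * B (suc n) - B n

Σ₁ : ℕ → (ℕ → ℤ) → ℤ
Σ₁ m f = foldr _+_ (+ 0) (applyUpTo (λ i → f (suc i)) m)

-- Sum over ordered quadruples (j₁,j₂,j₃,j₄) of positive integers with
-- j₁+j₂+j₃+j₄ = m of B j₁ B j₂ B j₃ B j₄ (each jᵢ ≤ m necessarily).
quadSum : ℕ → ℤ
quadSum m =
  Σ₁ m λ j₁ → Σ₁ m λ j₂ → Σ₁ m λ j₃ → Σ₁ m λ j₄ →
    (if ⌊ j₁ ℕ.+ j₂ ℕ.+ j₃ ℕ.+ j₄ ℕ.≟ m ⌋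
     then B j₁ * B j₂ * B j₃ * B j₄
     else + 0)

module Submission where

-- The quadruple sum is the four-fold convolution power of (B n): quadSum = B ⋆ B ⋆ B ⋆ B.
-- Convolving with B turns a sequence F into a solution of u (t + 2) = 6 u (t + 1) − u t + F (t + 1),
-- so, starting from B, each power has a closed form p(t) B t + q(t) B (t + 1) with polynomials p, q;
-- for the fourth power, 24576 (B ⋆ B ⋆ B ⋆ B) t = −(189 + 309t + 144t² + 24t³) B t + (103t + 8t³) B (t + 1).
-- For n = 10 + k, rewriting every B (j + k) through B k and B (k + 1) turns the claimed identity into a
-- polynomial identity in k, B k and B (k + 1), which the ring solver checks.

open import Defs
open import Data.Bool using (if_then_else_)
open import Data.Empty using (⊥-elim)
open import Data.Fin using (zero; suc)
open import Data.Integer using (ℤ; +_; _+_; _-_; _*_; -_; _^_)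
import Data.Integer.Properties as ℤ
open import Data.Integer.Tactic.RingSolver using (solve-∀; ring)
open import Data.List using (List; []; _∷_; foldr; map; upTo)
open import Data.List.Properties using (map-cong-local)
open import Data.List.Relation.Unary.All using ([]; _∷_)
open import Data.Nat as ℕ using (ℕ; zero; suc; _≤_; _<_; _∸_; z≤n; s≤s)
open import Data.Nat.Combinatorics using (_C_; nC1≡n; nCk+nC[k+1]≡[n+1]C[k+1])
open import Data.Nat.Divisibility using (_∣_; divides)
open import Data.Nat.DivMod using (m*[n/m]≡n)
import Data.Nat.Properties as ℕ
import Data.Nat.Tactic.RingSolver as ℕ-Solver
open import Data.Product using (_×_; _,_; proj₁; proj₂)
open import Data.Vec using (Vec) renaming ([] to []ᵛ; _∷_ to _∷ᵛ_)
open import Function using (_∘_)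
open import Relation.Binary.PropositionalEquality
  using (_≡_; _≢_; refl; sym; trans; cong; cong₂; module ≡-Reasoning)
open import Relation.Nullary using (yes; no)
open import Relation.Nullary.Decidable using (⌊_⌋)
open import Tactic.RingSolver.NonReflective ring using (Expr; Κ; Ι; _⊕_; _⊗_; ⊝_; solve; _⊜_; module Ops)

open ≡-Reasoning

Σ₁-cong⁺ : ∀ m {f g : ℕ → ℤ} → (∀ i → f (suc i) ≡ g (suc i)) → Σ₁ m f ≡ Σ₁ m g
Σ₁-cong⁺ zero    f≗g = refl
Σ₁-cong⁺ (suc m) {f} {g} f≗g = cong₂ _+_ (f≗g 0) (Σ₁-cong⁺ m {λ j → f (suc j)} {λ j → g (suc j)} (λ i → f≗g (suc i)))

Σ₁-cong : ∀ m {f g : ℕ → ℤ} → (∀ i → f i ≡ g i) → Σ₁ m f ≡ Σ₁ m g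
Σ₁-cong m {f} {g} f≗g = Σ₁-cong⁺ m {f} {g} (λ i → f≗g (suc i))

Σ₁-zero : ∀ m {f : ℕ → ℤ} → (∀ i → f (suc i) ≡ + 0) → Σ₁ m f ≡ + 0
Σ₁-zero zero    f≗0 = refl
Σ₁-zero (suc m) {f} f≗0 = cong₂ _+_ (f≗0 0) (Σ₁-zero m {λ j → f (suc j)} (λ i → f≗0 (suc i)))

Σ₁-*-distribˡ : ∀ m a (f : ℕ → ℤ) → Σ₁ m (λ j → a * f j) ≡ a * Σ₁ m f
Σ₁-*-distribˡ zero    a f = sym (ℤ.*-zeroʳ a)
Σ₁-*-distribˡ (suc m) a f = trans (cong (_+_ (a * f 1)) (Σ₁-*-distribˡ m a (λ j → f (suc j))))
                                  (sym (ℤ.*-distribˡ-+ a (f 1) _))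

Σ₁-distrib-- : ∀ m (f g : ℕ → ℤ) → Σ₁ m (λ j → f j - g j) ≡ Σ₁ m f - Σ₁ m g
Σ₁-distrib-- zero    f g = refl
Σ₁-distrib-- (suc m) f g = trans (cong (_+_ (f 1 - g 1)) (Σ₁-distrib-- m (λ j → f (suc j)) (λ j → g (suc j))))
                                 (interchange (f 1) (g 1) _ _)
  where
  interchange : ∀ a b c d → a - b + (c - d) ≡ a + c - (b + d)
  interchange = solve-∀

Σ₁-single : ∀ {m} k {f : ℕ → ℤ} → k < m → (∀ i → i ≢ k → f (suc i) ≡ + 0) → Σ₁ m f ≡ f (suc k)
Σ₁-single {suc m} zero    {f} _         f≗0 =
  trans (cong (_+_ (f 1)) (Σ₁-zero m {λ j → f (suc j)} (λ i → f≗0 (suc i) (λ ())))) (ℤ.+-identityʳ (f 1))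
Σ₁-single {suc m} (suc k) {f} (s≤s k<m) f≗0 =
  begin
    f 1 + Σ₁ m (λ j → f (suc j))  ≡⟨ cong (_+ Σ₁ m (λ j → f (suc j))) (f≗0 0 (λ ())) ⟩
    + 0 + Σ₁ m (λ j → f (suc j))  ≡⟨ ℤ.+-identityˡ _ ⟩
    Σ₁ m (λ j → f (suc j))        ≡⟨ Σ₁-single k {λ j → f (suc j)} k<m (λ i i≢k → f≗0 (suc i) (i≢k ∘ ℕ.suc-injective)) ⟩
    f (suc (suc k))               ∎

Σ₁-pad : ∀ {t m} (f : ℕ → ℤ) → t ≤ m → (∀ i → t ≤ i → f (suc i) ≡ + 0) → Σ₁ m f ≡ Σ₁ t f
Σ₁-pad {zero}  {m}    f _         f≗0 = Σ₁-zero m {f} (λ i → f≗0 i z≤n)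
Σ₁-pad {suc t} {suc m} f (s≤s t≤m) f≗0 =
  cong (_+_ (f 1)) (Σ₁-pad (λ j → f (suc j)) t≤m (λ i t≤i → f≗0 (suc i) (s≤s t≤i)))

if-≟-yes : ∀ {m n} (a b : ℤ) → m ≡ n → (if ⌊ m ℕ.≟ n ⌋ then a else b) ≡ a
if-≟-yes {m} {n} a b m≡n with m ℕ.≟ n
... | yes _   = refl
... | no  m≢n = ⊥-elim (m≢n m≡n)

if-≟-no : ∀ {m n} (a b : ℤ) → m ≢ n → (if ⌊ m ℕ.≟ n ⌋ then a else b) ≡ b
if-≟-no {m} {n} a b m≢n with m ℕ.≟ n
... | yes m≡n = ⊥-elim (m≢n m≡n)
... | no  _   = refl

Σ₁-select : ∀ m s (g : ℕ → ℤ) → g 0 ≡ + 0 →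
            Σ₁ m (λ j → if ⌊ s ℕ.+ j ℕ.≟ m ⌋ then g j else + 0) ≡ g (m ∸ s)
Σ₁-select m s g g0≡0 with m ℕ.≤? s
... | yes m≤s = begin
  Σ₁ m select  ≡⟨ Σ₁-zero m {select} (λ i → if-≟-no (g (suc i)) _ (ℕ.>⇒≢ (ℕ.≤-<-trans m≤s (ℕ.m<m+n s (s≤s z≤n))))) ⟩
  + 0          ≡⟨ sym g0≡0 ⟩
  g 0          ≡⟨ cong g (sym (ℕ.m≤n⇒m∸n≡0 m≤s)) ⟩
  g (m ∸ s)    ∎
  where
  select : ℕ → ℤ
  select j = if ⌊ s ℕ.+ j ℕ.≟ m ⌋ then g j else + 0
... | no m≰s with ℕ.m≤n⇒∃[o]m+o≡n (ℕ.≰⇒> m≰s)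
...   | k , refl = begin
  Σ₁ (suc (s ℕ.+ k)) select  ≡⟨ Σ₁-single k {select} (s≤s (ℕ.m≤n+m k s)) (λ i i≢k → if-≟-no (g (suc i)) _ (i≢k ∘ miss i)) ⟩
  select (suc k)             ≡⟨ if-≟-yes (g (suc k)) _ (ℕ.+-suc s k) ⟩
  g (suc k)                  ≡⟨ cong g (sym suc[s+k]∸s) ⟩
  g (suc (s ℕ.+ k) ∸ s)      ∎
  where
  select : ℕ → ℤ
  select j = if ⌊ s ℕ.+ j ℕ.≟ suc (s ℕ.+ k) ⌋ then g j else + 0
  miss : ∀ i → s ℕ.+ suc i ≡ suc (s ℕ.+ k) → i ≡ k
  miss i eq = ℕ.suc-injective (ℕ.+-cancelˡ-≡ s _ _ (trans eq (sym (ℕ.+-suc s k))))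
  suc[s+k]∸s : suc (s ℕ.+ k) ∸ s ≡ suc k
  suc[s+k]∸s = trans (cong (_∸ s) (sym (ℕ.+-suc s k))) (ℕ.m+n∸m≡n s (suc k))

-- Sums over 1 ≤ j ≤ t only; the omitted term F 0 * G t vanishes for F = B.
_⋆_ : (ℕ → ℤ) → (ℕ → ℤ) → ℕ → ℤ
(F ⋆ G) t = Σ₁ t (λ j → F j * G (t ∸ j))

⋆-pad : ∀ {t m} (F G : ℕ → ℤ) → G 0 ≡ + 0 → t ≤ m → Σ₁ m (λ j → F j * G (t ∸ j)) ≡ (F ⋆ G) t
⋆-pad {t} F G G0≡0 t≤m = Σ₁-pad (λ j → F j * G (t ∸ j)) t≤m vanish
  where
  vanish : ∀ i → t ≤ i → F (suc i) * G (t ∸ suc i) ≡ + 0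
  vanish i t≤i = begin
    F (suc i) * G (t ∸ suc i)  ≡⟨ cong (λ k → F (suc i) * G k) (ℕ.m≤n⇒m∸n≡0 (ℕ.m≤n⇒m≤1+n t≤i)) ⟩
    F (suc i) * G 0            ≡⟨ cong (F (suc i) *_) G0≡0 ⟩
    F (suc i) * + 0            ≡⟨ ℤ.*-zeroʳ (F (suc i)) ⟩
    + 0                        ∎

⋆-peel : ∀ m s a (F G : ℕ → ℤ) → G 0 ≡ + 0 →
         Σ₁ m (λ j → a * F j * G (m ∸ (s ℕ.+ j))) ≡ a * (F ⋆ G) (m ∸ s)
⋆-peel m s a F G G0≡0 = begin
  Σ₁ m (λ j → a * F j * G (m ∸ (s ℕ.+ j)))  ≡⟨ Σ₁-cong m (λ j → trans (ℤ.*-assoc a (F j) (G (m ∸ (s ℕ.+ j))))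
                                                  (cong (λ k → a * (F j * G k)) (sym (ℕ.∸-+-assoc m s j)))) ⟩
  Σ₁ m (λ j → a * (F j * G (m ∸ s ∸ j)))    ≡⟨ Σ₁-*-distribˡ m a (λ j → F j * G (m ∸ s ∸ j)) ⟩
  a * Σ₁ m (λ j → F j * G (m ∸ s ∸ j))      ≡⟨ cong (a *_) (⋆-pad F G G0≡0 (ℕ.m∸n≤m m s)) ⟩
  a * (F ⋆ G) (m ∸ s)                       ∎

C₂ C₃ C₄ : ℕ → ℤ
C₂ = B ⋆ B
C₃ = B ⋆ C₂
C₄ = B ⋆ C₃

quadSum≡C₄ : ∀ m → quadSum m ≡ C₄ m
quadSum≡C₄ m = begin
  quadSum m
    ≡⟨ Σ₁-cong m (λ j₁ → Σ₁-cong m (λ j₂ → Σ₁-cong m (λ j₃ →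
         Σ₁-select m (j₁ ℕ.+ j₂ ℕ.+ j₃) (λ j → B j₁ * B j₂ * B j₃ * B j) (ℤ.*-zeroʳ (B j₁ * B j₂ * B j₃))))) ⟩
  Σ₁ m (λ j₁ → Σ₁ m (λ j₂ → Σ₁ m (λ j₃ → B j₁ * B j₂ * B j₃ * B (m ∸ (j₁ ℕ.+ j₂ ℕ.+ j₃)))))
    ≡⟨ Σ₁-cong m (λ j₁ → Σ₁-cong m (λ j₂ → ⋆-peel m (j₁ ℕ.+ j₂) (B j₁ * B j₂) B B refl)) ⟩
  Σ₁ m (λ j₁ → Σ₁ m (λ j₂ → B j₁ * B j₂ * C₂ (m ∸ (j₁ ℕ.+ j₂))))
    ≡⟨ Σ₁-cong m (λ j₁ → ⋆-peel m j₁ (B j₁) B C₂ refl) ⟩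
  Σ₁ m (λ j₁ → B j₁ * C₃ (m ∸ j₁))
    ≡⟨ ⋆-pad {m} B C₃ refl ℕ.≤-refl ⟩
  C₄ m
    ∎

-- B (j + 1) = 6 B j − B (j − 1) termwise; the last sum is (B ⋆ F) t again since B 0 = 0.
B⋆-recurrence : ∀ F t → (B ⋆ F) (2 ℕ.+ t) ≡ + 6 * (B ⋆ F) (1 ℕ.+ t) - (B ⋆ F) t + F (1 ℕ.+ t)
B⋆-recurrence F t = begin
  B 1 * F (suc t) + Σ₁ (suc t) (λ j → B (suc j) * F (suc t ∸ j))
    ≡⟨ cong (_+_ (B 1 * F (suc t))) (Σ₁-cong⁺ (suc t) {λ j → B (suc j) * F (suc t ∸ j)} {λ j → + 6 * term j - term′ j}
                                      (λ i → unfold-B (B (suc i)) (B i) (F (t ∸ i)))) ⟩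
  B 1 * F (suc t) + Σ₁ (suc t) (λ j → + 6 * term j - term′ j)
    ≡⟨ cong (_+_ (B 1 * F (suc t))) (Σ₁-distrib-- (suc t) (λ j → + 6 * term j) term′) ⟩
  B 1 * F (suc t) + (Σ₁ (suc t) (λ j → + 6 * term j) - Σ₁ (suc t) term′)
    ≡⟨ cong₂ (λ a b → B 1 * F (suc t) + (a - b)) (Σ₁-*-distribˡ (suc t) (+ 6) term) (ℤ.+-identityˡ _) ⟩
  + 1 * F (suc t) + (+ 6 * (B ⋆ F) (suc t) - (B ⋆ F) t)
    ≡⟨ rearrange (F (suc t)) (+ 6 * (B ⋆ F) (suc t)) ((B ⋆ F) t) ⟩
  + 6 * (B ⋆ F) (suc t) - (B ⋆ F) t + F (suc t)
    ∎
  where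
  term term′ : ℕ → ℤ
  term  j = B j * F (suc t ∸ j)
  term′ j = B (j ∸ 1) * F (suc t ∸ j)
  unfold-B : ∀ b₁ b₀ f → (+ 6 * b₁ - b₀) * f ≡ + 6 * (b₁ * f) - b₀ * f
  unfold-B = solve-∀
  rearrange : ∀ f a b → + 1 * f + (a - b) ≡ a - b + f
  rearrange = solve-∀

recurrence-unique : ∀ {u v f : ℕ → ℤ} → u 0 ≡ v 0 → u 1 ≡ v 1 →
  (∀ t → u (2 ℕ.+ t) ≡ + 6 * u (1 ℕ.+ t) - u t + f t) →
  (∀ t → v (2 ℕ.+ t) ≡ + 6 * v (1 ℕ.+ t) - v t + f t) →
  ∀ t → u t ≡ v t
recurrence-unique {u} {v} {f} u₀ u₁ u-rec v-rec t = proj₁ (consecutive t)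
  where
  consecutive : ∀ t → u t ≡ v t × u (suc t) ≡ v (suc t)
  consecutive zero    = u₀ , u₁
  consecutive (suc t) with consecutive t
  ... | uₜ , uₜ₊₁ = uₜ₊₁ , trans (u-rec t) (trans (cong₂ (λ a b → + 6 * a - b + f t) uₜ₊₁ uₜ) (sym (v-rec t)))

B⋆-closed-form : ∀ {F H G : ℕ → ℤ} (L M : ℤ) → (∀ t → L * F t ≡ H t) → F 0 ≡ + 0 →
  G 0 ≡ + 0 → G 1 ≡ + 0 → (∀ t → G (2 ℕ.+ t) ≡ + 6 * G (1 ℕ.+ t) - G t + M * H (1 ℕ.+ t)) →
  ∀ t → M * L * (B ⋆ F) t ≡ G t
B⋆-closed-form {F} {H} {G} L M LF≡H F₀ G₀ G₁ G-rec =
  recurrence-unique (trans (ℤ.*-zeroʳ (M * L)) (sym G₀)) u₁ u-rec G-rec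
  where
  u₁ : M * L * (B ⋆ F) 1 ≡ G 1
  u₁ = begin
    M * L * (+ 1 * F 0 + + 0)  ≡⟨ cong (λ x → M * L * (+ 1 * x + + 0)) F₀ ⟩
    M * L * + 0                ≡⟨ ℤ.*-zeroʳ (M * L) ⟩
    + 0                        ≡⟨ sym G₁ ⟩
    G 1                        ∎
  u-rec : ∀ t → M * L * (B ⋆ F) (2 ℕ.+ t) ≡ + 6 * (M * L * (B ⋆ F) (1 ℕ.+ t)) - M * L * (B ⋆ F) t + M * H (1 ℕ.+ t)
  u-rec t = begin
    M * L * (B ⋆ F) (2 ℕ.+ t)
      ≡⟨ cong (M * L *_) (B⋆-recurrence F t) ⟩
    M * L * (+ 6 * (B ⋆ F) (1 ℕ.+ t) - (B ⋆ F) t + F (1 ℕ.+ t))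
      ≡⟨ distribute M L ((B ⋆ F) (1 ℕ.+ t)) ((B ⋆ F) t) (F (1 ℕ.+ t)) ⟩
    + 6 * (M * L * (B ⋆ F) (1 ℕ.+ t)) - M * L * (B ⋆ F) t + M * (L * F (1 ℕ.+ t))
      ≡⟨ cong (λ x → + 6 * (M * L * (B ⋆ F) (1 ℕ.+ t)) - M * L * (B ⋆ F) t + M * x) (LF≡H (1 ℕ.+ t)) ⟩
    + 6 * (M * L * (B ⋆ F) (1 ℕ.+ t)) - M * L * (B ⋆ F) t + M * H (1 ℕ.+ t)
      ∎
    where
    distribute : ∀ m l c₁ c₀ f → m * l * (+ 6 * c₁ - c₀ + f) ≡ + 6 * (m * l * c₁) - m * l * c₀ + m * (l * f)
    distribute = solve-∀

2*[2+k]C2 : ∀ k → 2 ℕ.* ((2 ℕ.+ k) C 2) ≡ (2 ℕ.+ k) ℕ.* (1 ℕ.+ k)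
2*[2+k]C2 zero    = refl
2*[2+k]C2 (suc k) = begin
  2 ℕ.* ((3 ℕ.+ k) C 2)                           ≡⟨ cong (2 ℕ.*_) (sym (nCk+nC[k+1]≡[n+1]C[k+1] (2 ℕ.+ k) 1)) ⟩
  2 ℕ.* ((2 ℕ.+ k) C 1 ℕ.+ (2 ℕ.+ k) C 2)         ≡⟨ ℕ.*-distribˡ-+ 2 ((2 ℕ.+ k) C 1) _ ⟩
  2 ℕ.* ((2 ℕ.+ k) C 1) ℕ.+ 2 ℕ.* ((2 ℕ.+ k) C 2) ≡⟨ cong₂ (λ a b → 2 ℕ.* a ℕ.+ b) (nC1≡n (2 ℕ.+ k)) (2*[2+k]C2 k) ⟩
  2 ℕ.* (2 ℕ.+ k) ℕ.+ (2 ℕ.+ k) ℕ.* (1 ℕ.+ k)     ≡⟨ expand k ⟩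
  (3 ℕ.+ k) ℕ.* (2 ℕ.+ k)                         ∎
  where
  expand : ∀ k → 2 ℕ.* (2 ℕ.+ k) ℕ.+ (2 ℕ.+ k) ℕ.* (1 ℕ.+ k) ≡ (3 ℕ.+ k) ℕ.* (2 ℕ.+ k)
  expand = ℕ-Solver.solve-∀

6*[3+k]C3 : ∀ k → 6 ℕ.* ((3 ℕ.+ k) C 3) ≡ (3 ℕ.+ k) ℕ.* (2 ℕ.+ k) ℕ.* (1 ℕ.+ k)
6*[3+k]C3 zero    = refl
6*[3+k]C3 (suc k) = begin
  6 ℕ.* ((4 ℕ.+ k) C 3)                                     ≡⟨ cong (6 ℕ.*_) (sym (nCk+nC[k+1]≡[n+1]C[k+1] (3 ℕ.+ k) 2)) ⟩
  6 ℕ.* ((3 ℕ.+ k) C 2 ℕ.+ (3 ℕ.+ k) C 3)                   ≡⟨ regroup ((3 ℕ.+ k) C 2) _ ⟩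
  3 ℕ.* (2 ℕ.* ((3 ℕ.+ k) C 2)) ℕ.+ 6 ℕ.* ((3 ℕ.+ k) C 3)   ≡⟨ cong₂ (λ a b → 3 ℕ.* a ℕ.+ b) (2*[2+k]C2 (suc k)) (6*[3+k]C3 k) ⟩
  3 ℕ.* ((3 ℕ.+ k) ℕ.* (2 ℕ.+ k)) ℕ.+ (3 ℕ.+ k) ℕ.* (2 ℕ.+ k) ℕ.* (1 ℕ.+ k) ≡⟨ expand k ⟩
  (4 ℕ.+ k) ℕ.* (3 ℕ.+ k) ℕ.* (2 ℕ.+ k)                     ∎
  where
  regroup : ∀ a b → 6 ℕ.* (a ℕ.+ b) ≡ 3 ℕ.* (2 ℕ.* a) ℕ.+ 6 ℕ.* b
  regroup = ℕ-Solver.solve-∀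
  expand : ∀ k → 3 ℕ.* ((3 ℕ.+ k) ℕ.* (2 ℕ.+ k)) ℕ.+ (3 ℕ.+ k) ℕ.* (2 ℕ.+ k) ℕ.* (1 ℕ.+ k)
               ≡ (4 ℕ.+ k) ℕ.* (3 ℕ.+ k) ℕ.* (2 ℕ.+ k)
  expand = ℕ-Solver.solve-∀

3∣[7+k][5+k][3+k] : ∀ k → 3 ∣ (7 ℕ.+ k) ℕ.* (5 ℕ.+ k) ℕ.* (3 ℕ.+ k)
3∣[7+k][5+k][3+k] k = divides (2 ℕ.* c ℕ.+ (5 ℕ.+ k) ℕ.* (3 ℕ.+ k)) (begin
  (7 ℕ.+ k) ℕ.* (5 ℕ.+ k) ℕ.* (3 ℕ.+ k)                       ≡⟨ split k ⟩
  (5 ℕ.+ k) ℕ.* (4 ℕ.+ k) ℕ.* (3 ℕ.+ k) ℕ.+ 3 ℕ.* ((5 ℕ.+ k) ℕ.* (3 ℕ.+ k)) ≡⟨ cong (ℕ._+ 3 ℕ.* ((5 ℕ.+ k) ℕ.* (3 ℕ.+ k))) (sym (6*[3+k]C3 (2 ℕ.+ k))) ⟩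
  6 ℕ.* c ℕ.+ 3 ℕ.* ((5 ℕ.+ k) ℕ.* (3 ℕ.+ k))                 ≡⟨ factor c ((5 ℕ.+ k) ℕ.* (3 ℕ.+ k)) ⟩
  (2 ℕ.* c ℕ.+ (5 ℕ.+ k) ℕ.* (3 ℕ.+ k)) ℕ.* 3                 ∎)
  where
  c = (5 ℕ.+ k) C 3
  split : ∀ k → (7 ℕ.+ k) ℕ.* (5 ℕ.+ k) ℕ.* (3 ℕ.+ k) ≡ (5 ℕ.+ k) ℕ.* (4 ℕ.+ k) ℕ.* (3 ℕ.+ k) ℕ.+ 3 ℕ.* ((5 ℕ.+ k) ℕ.* (3 ℕ.+ k))
  split = ℕ-Solver.solve-∀
  factor : ∀ c d → 6 ℕ.* c ℕ.+ 3 ℕ.* d ≡ (2 ℕ.* c ℕ.+ d) ℕ.* 3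
  factor = ℕ-Solver.solve-∀

pos-*³ : ∀ a b c → + (a ℕ.* b ℕ.* c) ≡ + a * + b * + c
pos-*³ a b c = trans (ℤ.pos-* (a ℕ.* b) c) (cong (_* + c) (ℤ.pos-* a b))

6*C3-ℤ : ∀ {n} k → n ≡ 3 ℕ.+ k → + 6 * + (n C 3) ≡ (+ 3 + + k) * (+ 2 + + k) * (+ 1 + + k)
6*C3-ℤ k refl = trans (sym (ℤ.pos-* 6 ((3 ℕ.+ k) C 3))) (trans (cong +_ (6*[3+k]C3 k)) (pos-*³ (3 ℕ.+ k) (2 ℕ.+ k) (1 ℕ.+ k)))

3*[abc/3]-ℤ : ∀ {a b c} k → a ≡ 7 ℕ.+ k → b ≡ 5 ℕ.+ k → c ≡ 3 ℕ.+ k →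
              + 3 * + (a ℕ.* b ℕ.* c ℕ./ 3) ≡ (+ 7 + + k) * (+ 5 + + k) * (+ 3 + + k)
3*[abc/3]-ℤ k refl refl refl =
  trans (sym (ℤ.pos-* 3 ((7 ℕ.+ k) ℕ.* (5 ℕ.+ k) ℕ.* (3 ℕ.+ k) ℕ./ 3)))
        (trans (cong +_ (m*[n/m]≡n (3∣[7+k][5+k][3+k] k))) (pos-*³ (7 ℕ.+ k) (5 ℕ.+ k) (3 ℕ.+ k)))

weight : ℕ → ℤ
weight l = (- + 1) ^ l * + (5 C l)

alternating : (ℕ → ℤ) → ℕ → ℤ
alternating f n = foldr _+_ (+ 0) (map (λ l → weight l * f (n ∸ 2 ℕ.* l)) (upTo 6))

rhs : ℕ → ℤ
rhs n = + ((n ∸ 1) C 3) * B (n ∸ 3)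
      - + (((n ∸ 3) ℕ.* (n ∸ 5) ℕ.* (n ∸ 7)) ℕ./ 3) * B (n ∸ 5)
      + + ((n ∸ 7) C 3) * B (n ∸ 7)

foldr-map-scale : ∀ a (g h : ℕ → ℤ) xs → (∀ l → a * g l ≡ h l) →
                  a * foldr _+_ (+ 0) (map g xs) ≡ foldr _+_ (+ 0) (map h xs)
foldr-map-scale a g h []       ag≗h = ℤ.*-zeroʳ a
foldr-map-scale a g h (l ∷ xs) ag≗h = trans (ℤ.*-distribˡ-+ a (g l) _)
  (cong₂ _+_ (ag≗h l) (foldr-map-scale a g h xs ag≗h))

alternating-scale : ∀ a {f g : ℕ → ℤ} n → (∀ m → a * f m ≡ g m) → a * alternating f n ≡ alternating g n
alternating-scale a {f} {g} n af≗g = foldr-map-scale a _ _ (upTo 6)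
  (λ l → trans (swap a (weight l) (f (n ∸ 2 ℕ.* l))) (cong (weight l *_) (af≗g (n ∸ 2 ℕ.* l))))
  where
  swap : ∀ a w x → a * (w * x) ≡ w * (a * x)
  swap = solve-∀

-- A Form is a polynomial in τ, x, y read at τ = t, x = B t, y = B (t + 1) (see value);
-- shift j rewrites it at t + j in terms of the same B t and B (t + 1), using the recurrence of B.
Form : Set
Form = Expr ℤ 3 → Expr ℤ 3 → Expr ℤ 3 → Expr ℤ 3

Bᵉ : ℕ → Expr ℤ 3 → Expr ℤ 3 → Expr ℤ 3
Bᵉ zero          x y = x
Bᵉ (suc zero)    x y = y
Bᵉ (suc (suc j)) x y = Κ (+ 6) ⊗ Bᵉ (suc j) x y ⊕ ⊝ Bᵉ j x y

shift : ℕ → Form → Form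
shift j c τ x y = c (Κ (+ j) ⊕ τ) (Bᵉ j x y) (Bᵉ (suc j) x y)

c₂ c₃ c₄ : Form
c₂ τ x y = ⊝ (Κ (+ 3) ⊗ (Κ (+ 1) ⊕ τ)) ⊗ x ⊕ τ ⊗ y
c₃ τ x y = (Κ (+ 19) ⊕ Κ (+ 27) ⊗ τ ⊕ Κ (+ 8) ⊗ τ ⊗ τ) ⊗ x ⊕ ⊝ (Κ (+ 9) ⊗ τ ⊗ y)
c₄ τ x y = ⊝ (Κ (+ 189) ⊕ Κ (+ 309) ⊗ τ ⊕ Κ (+ 144) ⊗ τ ⊗ τ ⊕ Κ (+ 24) ⊗ τ ⊗ τ ⊗ τ) ⊗ x
         ⊕ (Κ (+ 103) ⊗ τ ⊕ Κ (+ 8) ⊗ τ ⊗ τ ⊗ τ) ⊗ y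

expr : Form → Expr ℤ 3
expr c = c (Ι zero) (Ι (suc zero)) (Ι (suc (suc zero)))

env : ℕ → Vec ℤ 3
env t = + t ∷ᵛ B t ∷ᵛ B (suc t) ∷ᵛ []ᵛ

Bᶠ : ℕ → Form
Bᶠ j τ x y = Bᵉ j x y

B-shift : ∀ j k → B (j ℕ.+ k) ≡ Ops.⟦ expr (Bᶠ j) ⟧ (env k)
B-shift zero          k = refl
B-shift (suc zero)    k = refl
B-shift (suc (suc j)) k = cong₂ (λ a b → + 6 * a - b) (B-shift (suc j) k) (B-shift j k)

Σᵉ : (ℕ → ℤ) → (ℕ → Form) → List ℕ → Form
Σᵉ w f xs τ x y = foldr _⊕_ (Κ (+ 0)) (map (λ l → Κ (w l) ⊗ f l τ x y) xs)

-- Opaque: unfolding the evaluation of shifted Forms lets conversion checking expand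
-- B (j + k) into exponentially large integer terms.
opaque
  ⟦_⟧₃ : Form → Vec ℤ 3 → ℤ
  ⟦ c ⟧₃ = Ops.⟦ expr c ⟧

  value : Form → ℕ → ℤ
  value c t = ⟦ c ⟧₃ (env t)

  prove₃ : ∀ ρ (c d : Form) → Ops.⟦ expr c ⇓⟧ ρ ≡ Ops.⟦ expr d ⇓⟧ ρ → ⟦ c ⟧₃ ρ ≡ ⟦ d ⟧₃ ρ
  prove₃ ρ c d = Ops.prove ρ (expr c) (expr d)

  ⟦Σᵉ⟧₃ : ∀ w f xs ρ → ⟦ Σᵉ w f xs ⟧₃ ρ ≡ foldr _+_ (+ 0) (map (λ l → w l * ⟦ f l ⟧₃ ρ) xs)
  ⟦Σᵉ⟧₃ w f []       ρ = refl
  ⟦Σᵉ⟧₃ w f (l ∷ xs) ρ = cong (_+_ (w l * ⟦ f l ⟧₃ ρ)) (⟦Σᵉ⟧₃ w f xs ρ)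

  c₂-recurrence : ∀ t → value c₂ (2 ℕ.+ t) ≡ + 6 * value c₂ (1 ℕ.+ t) - value c₂ t + + 16 * B (1 ℕ.+ t)
  c₂-recurrence t = solve 3 (λ τ x y →
    shift 2 c₂ τ x y ⊜ (Κ (+ 6) ⊗ shift 1 c₂ τ x y ⊕ ⊝ c₂ τ x y ⊕ Κ (+ 16) ⊗ y)) refl (+ t) (B t) (B (suc t))

  c₃-recurrence : ∀ t → value c₃ (2 ℕ.+ t) ≡ + 6 * value c₃ (1 ℕ.+ t) - value c₃ t + + 32 * value c₂ (1 ℕ.+ t)
  c₃-recurrence t = solve 3 (λ τ x y →
    shift 2 c₃ τ x y ⊜ (Κ (+ 6) ⊗ shift 1 c₃ τ x y ⊕ ⊝ c₃ τ x y ⊕ Κ (+ 32) ⊗ shift 1 c₂ τ x y)) refl (+ t) (B t) (B (suc t))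

  c₄-recurrence : ∀ t → value c₄ (2 ℕ.+ t) ≡ + 6 * value c₄ (1 ℕ.+ t) - value c₄ t + + 48 * value c₃ (1 ℕ.+ t)
  c₄-recurrence t = solve 3 (λ τ x y →
    shift 2 c₄ τ x y ⊜ (Κ (+ 6) ⊗ shift 1 c₄ τ x y ⊕ ⊝ c₄ τ x y ⊕ Κ (+ 48) ⊗ shift 1 c₃ τ x y)) refl (+ t) (B t) (B (suc t))

  C₂-closed : ∀ t → + 16 * C₂ t ≡ value c₂ t
  C₂-closed = B⋆-closed-form {B} {B} {value c₂} (+ 1) (+ 16) (λ t → ℤ.*-identityˡ (B t)) refl refl refl c₂-recurrence

  C₃-closed : ∀ t → + 512 * C₃ t ≡ value c₃ t
  C₃-closed = B⋆-closed-form {C₂} {value c₂} {value c₃} (+ 16) (+ 32) C₂-closed refl refl refl c₃-recurrence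

  C₄-closed : ∀ t → + 24576 * C₄ t ≡ value c₄ t
  C₄-closed = B⋆-closed-form {C₃} {value c₃} {value c₄} (+ 512) (+ 48) C₃-closed refl refl refl c₄-recurrence

  value-c₄-shift : ∀ j k → value c₄ (j ℕ.+ k) ≡ ⟦ shift j c₄ ⟧₃ (env k)
  value-c₄-shift j k = cong₂ (λ x y → ⟦ c₄ ⟧₃ (+ (j ℕ.+ k) ∷ᵛ x ∷ᵛ y ∷ᵛ []ᵛ)) (B-shift j k) (B-shift (suc j) k)

quadSum-closed : ∀ t → + 24576 * quadSum t ≡ value c₄ t
quadSum-closed t = trans (cong (+ 24576 *_) (quadSum≡C₄ t)) (C₄-closed t)

cubic : ℤ → ℤ → ℤ → ℤ → Form
cubic a i j l τ x y = Κ a ⊗ ((Κ i ⊕ τ) ⊗ (Κ j ⊕ τ) ⊗ (Κ l ⊕ τ))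

alternatingᵉ rhsᵉ : Form
alternatingᵉ = Σᵉ weight (λ l → shift (10 ∸ 2 ℕ.* l) c₄) (upTo 6)
rhsᵉ τ x y = cubic (+ 4096) (+ 9) (+ 8) (+ 7) τ x y ⊗ Bᶠ 7 τ x y
           ⊕ ⊝ (cubic (+ 8192) (+ 7) (+ 5) (+ 3) τ x y ⊗ Bᶠ 5 τ x y)
           ⊕ cubic (+ 4096) (+ 3) (+ 2) (+ 1) τ x y ⊗ Bᶠ 3 τ x y

alternating-identity : ∀ ρ → ⟦ alternatingᵉ ⟧₃ ρ ≡ ⟦ rhsᵉ ⟧₃ ρ
alternating-identity (τ ∷ᵛ x ∷ᵛ y ∷ᵛ []ᵛ) = prove₃ (τ ∷ᵛ x ∷ᵛ y ∷ᵛ []ᵛ) alternatingᵉ rhsᵉ refl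

opaque
  unfolding ⟦_⟧₃

  ⟦cubic⟧₃ : ∀ a i j l k → ⟦ cubic a i j l ⟧₃ (env k) ≡ a * ((i + + k) * (j + + k) * (l + + k))
  ⟦cubic⟧₃ a i j l k = refl

  ⟦Bᶠ⟧₃ : ∀ j k {n} → j ℕ.+ k ≡ n → ⟦ Bᶠ j ⟧₃ (env k) ≡ B n
  ⟦Bᶠ⟧₃ j k refl = sym (B-shift j k)

  ⟦⊗−⊗+⊗⟧₃ : ∀ p₁ q₁ p₂ q₂ p₃ q₃ ρ →
    ⟦ (λ τ x y → p₁ τ x y ⊗ q₁ τ x y ⊕ ⊝ (p₂ τ x y ⊗ q₂ τ x y) ⊕ p₃ τ x y ⊗ q₃ τ x y) ⟧₃ ρ
    ≡ ⟦ p₁ ⟧₃ ρ * ⟦ q₁ ⟧₃ ρ - ⟦ p₂ ⟧₃ ρ * ⟦ q₂ ⟧₃ ρ + ⟦ p₃ ⟧₃ ρ * ⟦ q₃ ⟧₃ ρ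
  ⟦⊗−⊗+⊗⟧₃ p₁ q₁ p₂ q₂ p₃ q₃ ρ = refl

-- Here and below n stays abstract, tied to 10 + k by an equation, so that conversion checking
-- never unfolds B (n ∸ 3) and its neighbours.
rhsᵉ-value : ∀ {n} k → n ≡ 10 ℕ.+ k → ⟦ rhsᵉ ⟧₃ (env k)
  ≡ + 4096 * ((+ 9 + + k) * (+ 8 + + k) * (+ 7 + + k)) * B (n ∸ 3)
  - + 8192 * ((+ 7 + + k) * (+ 5 + + k) * (+ 3 + + k)) * B (n ∸ 5)
  + + 4096 * ((+ 3 + + k) * (+ 2 + + k) * (+ 1 + + k)) * B (n ∸ 7)
rhsᵉ-value k n≡10+k = trans
  (⟦⊗−⊗+⊗⟧₃ (cubic (+ 4096) (+ 9) (+ 8) (+ 7)) (Bᶠ 7) (cubic (+ 8192) (+ 7) (+ 5) (+ 3)) (Bᶠ 5)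
             (cubic (+ 4096) (+ 3) (+ 2) (+ 1)) (Bᶠ 3) (env k))
  (cong₂ _+_ (cong₂ _-_ (cong₂ _*_ (⟦cubic⟧₃ _ _ _ _ k) (⟦Bᶠ⟧₃ 7 k (sym (cong (_∸ 3) n≡10+k))))
                        (cong₂ _*_ (⟦cubic⟧₃ _ _ _ _ k) (⟦Bᶠ⟧₃ 5 k (sym (cong (_∸ 5) n≡10+k)))))
             (cong₂ _*_ (⟦cubic⟧₃ _ _ _ _ k) (⟦Bᶠ⟧₃ 3 k (sym (cong (_∸ 7) n≡10+k)))))

alternating-value-c₄ : ∀ {n} k → n ≡ 10 ℕ.+ k → alternating (value c₄) n ≡ ⟦ alternatingᵉ ⟧₃ (env k)
alternating-value-c₄ k refl = trans
  (cong (foldr _+_ (+ 0)) (map-cong-local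
      {f = λ l → weight l * value c₄ (10 ℕ.+ k ∸ 2 ℕ.* l)}
      {g = λ l → weight l * ⟦ shift (10 ∸ 2 ℕ.* l) c₄ ⟧₃ (env k)} {xs = upTo 6}
    ( cong (weight 0 *_) (value-c₄-shift 10 k) ∷ cong (weight 1 *_) (value-c₄-shift 8 k)
    ∷ cong (weight 2 *_) (value-c₄-shift 6 k) ∷ cong (weight 3 *_) (value-c₄-shift 4 k)
    ∷ cong (weight 4 *_) (value-c₄-shift 2 k) ∷ cong (weight 5 *_) (value-c₄-shift 0 k) ∷ [])))
  (sym (⟦Σᵉ⟧₃ weight (λ l → shift (10 ∸ 2 ℕ.* l) c₄) (upTo 6) (env k)))

rhs-scaled : ∀ {n} k → n ≡ 10 ℕ.+ k → + 24576 * rhs n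
  ≡ + 4096 * ((+ 9 + + k) * (+ 8 + + k) * (+ 7 + + k)) * B (n ∸ 3)
  - + 8192 * ((+ 7 + + k) * (+ 5 + + k) * (+ 3 + + k)) * B (n ∸ 5)
  + + 4096 * ((+ 3 + + k) * (+ 2 + + k) * (+ 1 + + k)) * B (n ∸ 7)
rhs-scaled {n} k n≡10+k = begin
  + 24576 * rhs n
    ≡⟨ regroup (+ ((n ∸ 1) C 3)) (+ ((n ∸ 3) ℕ.* (n ∸ 5) ℕ.* (n ∸ 7) ℕ./ 3)) (+ ((n ∸ 7) C 3))
               (B (n ∸ 3)) (B (n ∸ 5)) (B (n ∸ 7)) ⟩
  + 4096 * (+ 6 * + ((n ∸ 1) C 3)) * B (n ∸ 3)
  - + 8192 * (+ 3 * + ((n ∸ 3) ℕ.* (n ∸ 5) ℕ.* (n ∸ 7) ℕ./ 3)) * B (n ∸ 5)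
  + + 4096 * (+ 6 * + ((n ∸ 7) C 3)) * B (n ∸ 7)
    ≡⟨ cong₂ _+_ (cong₂ _-_ (cong (λ z → + 4096 * z * B (n ∸ 3)) (6*C3-ℤ (6 ℕ.+ k) (at 1)))
                            (cong (λ z → + 8192 * z * B (n ∸ 5)) (3*[abc/3]-ℤ k (at 3) (at 5) (at 7))))
                 (cong (λ z → + 4096 * z * B (n ∸ 7)) (6*C3-ℤ k (at 7))) ⟩
  + 4096 * ((+ 9 + + k) * (+ 8 + + k) * (+ 7 + + k)) * B (n ∸ 3)
  - + 8192 * ((+ 7 + + k) * (+ 5 + + k) * (+ 3 + + k)) * B (n ∸ 5)
  + + 4096 * ((+ 3 + + k) * (+ 2 + + k) * (+ 1 + + k)) * B (n ∸ 7)
    ∎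
  where
  at : ∀ d → n ∸ d ≡ 10 ℕ.+ k ∸ d
  at d = cong (_∸ d) n≡10+k
  regroup : ∀ a w c p q r → + 24576 * (a * p - w * q + c * r)
                          ≡ + 4096 * (+ 6 * a) * p - + 8192 * (+ 3 * w) * q + + 4096 * (+ 6 * c) * r
  regroup = solve-∀

alternating-quadSum≡rhs : ∀ {n} k → n ≡ 10 ℕ.+ k → alternating quadSum n ≡ rhs n
alternating-quadSum≡rhs {n} k n≡10+k = ℤ.*-cancelˡ-≡ (+ 24576) (alternating quadSum n) (rhs n) (begin
  + 24576 * alternating quadSum n  ≡⟨ alternating-scale (+ 24576) {quadSum} {value c₄} n quadSum-closed ⟩
  alternating (value c₄) n        ≡⟨ alternating-value-c₄ k n≡10+k ⟩
  ⟦ alternatingᵉ ⟧₃ (env k)       ≡⟨ alternating-identity (env k) ⟩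
  ⟦ rhsᵉ ⟧₃ (env k)               ≡⟨ rhsᵉ-value k n≡10+k ⟩
  _                               ≡⟨ rhs-scaled k n≡10+k ⟨
  + 24576 * rhs n                 ∎)

corollary1 : (n : ℕ) → 7 ≤ n →
    foldr _+_ (+ 0)
      (map (λ l → (- + 1) ^ l * + (5 C l) * quadSum (n ∸ 2 ℕ.* l)) (upTo 6))
    ≡ + ((n ∸ 1) C 3) * B (n ∸ 3)
      - + (((n ∸ 3) ℕ.* (n ∸ 5) ℕ.* (n ∸ 7)) ℕ./ 3) * B (n ∸ 5)
      + + ((n ∸ 7) C 3) * B (n ∸ 7)
corollary1 n 7≤n = from-7 (proj₂ (ℕ.m≤n⇒∃[o]m+o≡n 7≤n))
  where
  -- For n < 10 some indices n ∸ 2 l are truncated at 0, so these cases are checked by evaluation.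
  from-7 : ∀ {o} → 7 ℕ.+ o ≡ n → alternating quadSum n ≡ rhs n
  from-7 {0}                 refl = refl
  from-7 {1}                 refl = refl
  from-7 {2}                 refl = refl
  from-7 {suc (suc (suc k))} eq   = alternating-quadSum≡rhs k (sym eq)
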